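{- Let $n=p_1^{n_1}p_2^{n_2}\cdots p_r^{n_r}$, where $r\geq 2$, $n_1,\ldots,n_r$ are positive integers and $p_1,\ldots,p_r$ are distinct primes with $p_1<p_2<\cdots<p_r$, and let $0\leq k\leq n_r-1$. For $0\leq j\leq n_r-1$ put $\alpha_j=p_1^{n_1}\cdots p_{r-1}^{n_{r-1}}p_r^{j}$, and for $1\leq i\leq r-1$ put $\beta_{k,i}=\alpha_k/p_i$. Define $$Z(r,k)=E_{\alpha_{k+1}}\cup\cdots\cup E_{\alpha_{n_r-1}}\cup E_n\cup S_{\beta_{k,1}}\cup\cdots\cup S_{\beta_{k,r-1}}\subseteq C_n.$$ Then the induced subgraph of $\mathcal{P}(C_n)$ on $C_n\setminus Z(r,k)$ is disconnected.
   Context: $C_n$ is the cyclic group of order $n$. The power graph $\mathcal{P}(C_n)$ is the simple undirected graph with vertex set $C_n$ in which two distinct vertices are adjacent if and only if one of them is a power of the other. For a positive divisor $d$ of $n$, $E_d$ is the set of elements of $C_n$ of order exactly $d$, and $S_d$ is the set of elements of $C_n$ whose order divides $d$ (the unique subgroup of order $d$). When $k=n_r-1$, the union $E_{\alpha_{k+1}}\cup\cdots\cup E_{\alpha_{n_r-1}}$ is empty. -}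

module Defs where

open import Data.Nat using (ℕ; zero; suc; _+_; _*_; _^_; _≤_; _<_)
open import Data.Nat.DivMod using (_/_; _%_)
open import Data.Nat.Divisibility using (_∣_)
open import Data.Fin using (Fin; toℕ; fromℕ; inject₁)
open import Data.Product using (Σ; _×_; ∃)
open import Data.Sum using (_⊎_)
open import Relation.Nullary using (¬_)
open import Relation.Binary.PropositionalEquality using (_≡_)

prodF : {r : ℕ} → (Fin r → ℕ) → ℕ
prodF {zero} f = 1
prodF {suc r} f = f Fin.zero * prodF (λ i → f (Fin.suc i))

-- total division / remainder (value 0 / a for divisor 0; never used with 0 here)
_div'_ : ℕ → ℕ → ℕ
a div' zero = 0
a div' suc b = a / suc b

_mod'_ : ℕ → ℕ → ℕ
a mod' zero = a
a mod' suc b = a % suc b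

-- C_n is modelled additively as Z/nZ with carrier Fin n.
-- y is a power of x:  y = x^m (additively: m·x mod n) for some m.
IsPower : (n : ℕ) → Fin n → Fin n → Set
IsPower n x y = ∃ λ (m : ℕ) → (m * toℕ x) mod' n ≡ toℕ y

Adj : (n : ℕ) → Fin n → Fin n → Set
Adj n x y = ¬ (x ≡ y) × (IsPower n x y ⊎ IsPower n y x)

IsOrder : (n : ℕ) → Fin n → ℕ → Set
IsOrder n x d = (0 < d) × (n ∣ d * toℕ x) × (∀ d' → 0 < d' → n ∣ d' * toℕ x → d ≤ d')

E : (n : ℕ) → ℕ → Fin n → Set
E n d x = IsOrder n x d

S : (n : ℕ) → ℕ → Fin n → Set
S n d x = Σ ℕ λ o → IsOrder n x o × (o ∣ d)

data Reach (n : ℕ) (V : Fin n → Set) (x : Fin n) : Fin n → Set where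
  here : Reach n V x x
  step : ∀ {y z} → Reach n V x y → Adj n y z → V z → Reach n V x z

Disconnected : (n : ℕ) → (Fin n → Set) → Set
Disconnected n V = Σ (Fin n) λ x → Σ (Fin n) λ y → V x × V y × ¬ Reach n V x y

-- Setting: r = suc m primes p 0 < ... < p m (p m = p_r), exponents e.
nOf : (m : ℕ) → (Fin (suc m) → ℕ) → (Fin (suc m) → ℕ) → ℕ
nOf m p e = prodF (λ i → p i ^ e i)

α : (m : ℕ) → (Fin (suc m) → ℕ) → (Fin (suc m) → ℕ) → ℕ → ℕ
α m p e j = prodF (λ (i : Fin m) → p (inject₁ i) ^ e (inject₁ i)) * p (fromℕ m) ^ j

β : (m : ℕ) → (Fin (suc m) → ℕ) → (Fin (suc m) → ℕ) → ℕ → Fin m → ℕ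
β m p e k i = α m p e k div' p (inject₁ i)

InZ : (m : ℕ) → (p e : Fin (suc m) → ℕ) → ℕ → Fin (nOf m p e) → Set
InZ m p e k x =
  (Σ ℕ λ j → (k < j) × (j < e (fromℕ m)) × E (nOf m p e) (α m p e j) x)
  ⊎ E (nOf m p e) (nOf m p e) x
  ⊎ (Σ (Fin m) λ i → S (nOf m p e) (β m p e k i) x)

module Submission where

-- Write a = p₁^n₁ ⋯ pᵣ₋₁^nᵣ₋₁, so that α_j = a · pᵣ^j and n = α_{nᵣ}. Outside Z(r,k) the
-- property "the order of x divides α_k" is preserved along edges. Passing to a power only
-- shrinks the order; and if x is a power of y with ord x ∣ α_k, then x ∉ S_{β_{k,i}} forces
-- a ∣ ord x ∣ ord y ∣ n, so ord y = α_j, and y ∉ E_{α_{k+1}} ∪ ⋯ ∪ E_n leaves j ≤ k.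
-- The element pᵣ^nᵣ (of order a) has the property and the element a (of order pᵣ^nᵣ)
-- does not, while neither lies in Z(r,k).

open import Defs
open import Data.Nat
open import Data.Nat.Properties
open import Data.Nat.DivMod
open import Data.Nat.Divisibility
open import Data.Nat.Primality
open import Data.Nat.Coprimality as Coprimality using (Coprime; coprime-divisor)
open import Data.Nat.Induction using (<-wellFounded)
open import Data.Nat.Solver using (module +-*-Solver)
open import Data.Fin using (Fin; toℕ; fromℕ; inject₁; fromℕ<)
open import Data.Fin.Properties using (nonZeroIndex; toℕ-fromℕ<; toℕ-fromℕ; inject₁ℕ<)
open import Data.Product
open import Data.Sum
open import Data.Empty
open import Induction.WellFounded using (Acc; acc)
open import Relation.Nullary
open import Relation.Unary using (Pred; Decidable)
open import Relation.Binary.PropositionalEquality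

open +-*-Solver using (solve; _:=_; _:+_; _:*_)

least-witness : ∀ {ℓ} {P : Pred ℕ ℓ} → Decidable P → ∀ {n} → P n
  → ∃ λ m → P m × (∀ {k} → k < m → ¬ P k)
least-witness {P = P} P? = go (<-wellFounded _)
  where
  go : ∀ {n} → Acc _<_ n → P n → ∃ λ m → P m × (∀ {k} → k < m → ¬ P k)
  go {n} (acc rs) Pn with anyUpTo? P? n
  ... | yes (k , k<n , Pk) = go (rs k<n) Pk
  ... | no ∄k = n , Pn , λ k<n Pk → ∄k (_ , k<n , Pk)

[m*[n%o]]%o≡[m*n]%o : ∀ m n o .{{_ : NonZero o}} → (m * (n % o)) % o ≡ (m * n) % o
[m*[n%o]]%o≡[m*n]%o m n o = begin
  (m * (n % o)) % o             ≡⟨ %-distribˡ-* m (n % o) o ⟩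
  ((m % o) * (n % o % o)) % o   ≡⟨ cong (λ t → ((m % o) * t) % o) (m%n%n≡m%n n o) ⟩
  ((m % o) * (n % o)) % o       ≡⟨ %-distribˡ-* m n o ⟨
  (m * n) % o                   ∎
  where open ≡-Reasoning

div'-*-inverse : ∀ {m n} → 0 < n → n ∣ m → m div' n * n ≡ m
div'-*-inverse {n = suc _} _ = m/n*n≡m

order-exists : ∀ {N} (x : Fin N) → ∃ (IsOrder N x)
order-exists {N} x with least-witness (λ d → 0 <? d ×-dec N ∣? d * toℕ x)
                          (>-nonZero⁻¹ N {{nonZeroIndex x}} , m∣m*n (toℕ x))
... | o , (o>0 , N∣ox) , below =
  o , o>0 , N∣ox , λ d d>0 N∣dx → ≮⇒≥ λ d<o → below d<o (d>0 , N∣dx)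

order-unique : ∀ {N x o o′} → IsOrder N x o → IsOrder N x o′ → o ≡ o′
order-unique (o>0 , N∣ox , o-least) (o′>0 , N∣o′x , o′-least) =
  ≤-antisym (o-least _ o′>0 N∣o′x) (o′-least _ o>0 N∣ox)

annihilates⇒order-∣ : ∀ {N x o d} → IsOrder N x o → N ∣ d * toℕ x → o ∣ d
annihilates⇒order-∣ {N} {x} {o} {d} (o>0 , N∣ox , o-least) N∣dx = m%n≡0⇒n∣m d o remainder≡0
  where
  instance _ = >-nonZero o>0
  v = toℕ x
  d≡ : d * v ≡ d / o * (o * v) + d % o * v
  d≡ = begin
    d * v                         ≡⟨ cong (_* v) (m≡m%n+[m/n]*n d o) ⟩
    (d % o + d / o * o) * v       ≡⟨ solve 4 (λ r s o v → (r :+ s :* o) :* v := s :* (o :* v) :+ r :* v)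
                                           refl (d % o) (d / o) o v ⟩
    d / o * (o * v) + d % o * v   ∎
    where open ≡-Reasoning
  N∣remainder : N ∣ d % o * v
  N∣remainder = ∣m+n∣m⇒∣n (subst (N ∣_) d≡ N∣dx) (∣n⇒∣m*n (d / o) N∣ox)
  remainder≡0 : d % o ≡ 0
  remainder≡0 with d % o | m%n<n d o | N∣remainder
  ... | zero  | _ | _ = refl
  ... | suc r | r<o | N∣rv = ⊥-elim (<⇒≱ r<o (o-least (suc r) z<s N∣rv))

order-∣⇒annihilates : ∀ {N x o d} → IsOrder N x o → o ∣ d → N ∣ d * toℕ x
order-∣⇒annihilates {N} {x} {o} (_ , N∣ox , _) (divides c refl) =
  subst (N ∣_) (sym (*-assoc c o (toℕ x))) (∣n⇒∣m*n c N∣ox)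

order-∣-modulus : ∀ {N x o} → IsOrder N x o → o ∣ N
order-∣-modulus {x = x} ox = annihilates⇒order-∣ ox (m∣m*n (toℕ x))

annihilates-power : ∀ {N x y d} → IsPower N x y → N ∣ d * toℕ x → N ∣ d * toℕ y
annihilates-power {N@(suc _)} {x} {y} {d} (c , c·x≡y) N∣dx =
  m%n≡0⇒n∣m (d * toℕ y) N (begin
    (d * toℕ y) % N                 ≡⟨ cong (λ t → (d * t) % N) c·x≡y ⟨
    (d * ((c * toℕ x) % N)) % N     ≡⟨ [m*[n%o]]%o≡[m*n]%o d (c * toℕ x) N ⟩
    (d * (c * toℕ x)) % N           ≡⟨ cong (_% N) (solve 3 (λ d c x → d :* (c :* x) := c :* (d :* x))
                                                              refl d c (toℕ x)) ⟩
    (c * (d * toℕ x)) % N           ≡⟨ n∣m⇒m%n≡0 _ N (∣n⇒∣m*n c N∣dx) ⟩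
    0                               ∎)
  where open ≡-Reasoning

order-∣-of-power : ∀ {N x y ox oy} → IsPower N x y → IsOrder N x ox → IsOrder N y oy → oy ∣ ox
order-∣-of-power {ox = ox} x↦y (_ , N∣ox , _) oy =
  annihilates⇒order-∣ oy (annihilates-power {d = ox} x↦y N∣ox)

order-of-cofactor : ∀ {N u v} {x : Fin N} .{{_ : NonZero u}} .{{_ : NonZero v}}
  → N ≡ u * v → toℕ x ≡ v → IsOrder N x u
order-of-cofactor {u = u} {v} refl x≡v rewrite x≡v =
  >-nonZero⁻¹ u , ∣-refl , λ d d>0 uv∣dv → ∣⇒≤ {{>-nonZero d>0}} (*-cancelʳ-∣ v uv∣dv)

prime∤⇒coprime : ∀ {p c} → Prime p → ¬ p ∣ c → Coprime p c
prime∤⇒coprime pp p∤c (d∣p , d∣c) with prime⇒irreducible pp d∣p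
... | inj₁ d≡1 = d≡1
... | inj₂ refl = ⊥-elim (p∤c d∣c)

distinct-primes-coprime : ∀ {p q} → Prime p → Prime q → p ≢ q → Coprime p q
distinct-primes-coprime pp@(prime _) pq p≢q =
  prime∤⇒coprime pp λ p∣q → [ nonTrivial⇒≢1 , p≢q ]′ (prime⇒irreducible pq p∣q)

coprime-* : ∀ {b c x} → Coprime b x → Coprime c x → Coprime (b * c) x
coprime-* {b} {c} {x} b⊥x c⊥x {d} (d∣bc , d∣x) = c⊥x (coprime-divisor d⊥b d∣bc , d∣x)
  where
  d⊥b : Coprime d b
  d⊥b (t∣d , t∣b) = b⊥x (t∣b , ∣-trans t∣d d∣x)

coprime-^ : ∀ {b x} n → Coprime b x → Coprime (b ^ n) x
coprime-^ zero    _   = Coprimality.1-coprimeTo _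
coprime-^ (suc n) b⊥x = coprime-* b⊥x (coprime-^ n b⊥x)

coprime-prodF : ∀ {m x} (f : Fin m → ℕ) → (∀ i → Coprime (f i) x) → Coprime (prodF f) x
coprime-prodF {zero}  f _   = Coprimality.1-coprimeTo _
coprime-prodF {suc m} f f⊥x =
  coprime-* (f⊥x Data.Fin.zero) (coprime-prodF (λ i → f (Data.Fin.suc i)) (λ i → f⊥x (Data.Fin.suc i)))

∣prodF : ∀ {m} (f : Fin m → ℕ) i → f i ∣ prodF f
∣prodF f Data.Fin.zero    = m∣m*n _
∣prodF f (Data.Fin.suc i) = ∣n⇒∣m*n (f Data.Fin.zero) (∣prodF (λ j → f (Data.Fin.suc j)) i)

prodF-last : ∀ m (f : Fin (suc m) → ℕ) → prodF f ≡ prodF (λ i → f (inject₁ i)) * f (fromℕ m)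
prodF-last zero    f = solve 1 (λ x → x :* con 1 := con 1 :* x) refl (f Data.Fin.zero)
  where open +-*-Solver using (con)
prodF-last (suc m) f = begin
  f Data.Fin.zero * prodF (λ i → f (Data.Fin.suc i))
    ≡⟨ cong (f Data.Fin.zero *_) (prodF-last m (λ i → f (Data.Fin.suc i))) ⟩
  f Data.Fin.zero * (prodF (λ i → f (Data.Fin.suc (inject₁ i))) * f (fromℕ (suc m)))
    ≡⟨ *-assoc (f Data.Fin.zero) _ _ ⟨
  f Data.Fin.zero * prodF (λ i → f (Data.Fin.suc (inject₁ i))) * f (fromℕ (suc m))
    ∎
  where open ≡-Reasoning

m∣m^n : ∀ m {n} → 0 < n → m ∣ m ^ n
m∣m^n m {suc n} _ = m∣m*n (m ^ n)

^-monoʳ-∣ : ∀ m {j k} → j ≤ k → m ^ j ∣ m ^ k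
^-monoʳ-∣ m {k = k} z≤n     = 1∣ (m ^ k)
^-monoʳ-∣ m         (s≤s j≤k) = *-pres-∣ (∣-refl {m}) (^-monoʳ-∣ m j≤k)

prodF-nonZero : ∀ {m} (f : Fin m → ℕ) → (∀ i → NonZero (f i)) → NonZero (prodF f)
prodF-nonZero {zero}  f _      = _
prodF-nonZero {suc m} f f≢0 =
  m*n≢0 _ _ {{f≢0 Data.Fin.zero}}
            {{prodF-nonZero (λ i → f (Data.Fin.suc i)) (λ i → f≢0 (Data.Fin.suc i))}}

∣prime^⇒≡prime^ : ∀ {q t} → Prime q → ∀ n → t ∣ q ^ n → ∃ λ j → j ≤ n × t ≡ q ^ j
∣prime^⇒≡prime^ pq zero t∣1 = 0 , z≤n , ∣1⇒≡1 t∣1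
∣prime^⇒≡prime^ {q} {t} pq (suc n) t∣q^1+n with q ∣? t
... | no q∤t =
  let t∣q^n = coprime-divisor (Coprimality.sym (prime∤⇒coprime pq q∤t)) t∣q^1+n
      j , j≤n , t≡q^j = ∣prime^⇒≡prime^ pq n t∣q^n
  in j , m≤n⇒m≤1+n j≤n , t≡q^j
... | yes (divides s refl) =
  let instance _ = prime⇒nonZero pq
      s∣q^n = *-cancelʳ-∣ {s} q (subst (s * q ∣_) (*-comm q (q ^ n)) t∣q^1+n)
      j , j≤n , s≡q^j = ∣prime^⇒≡prime^ pq n s∣q^n
  in suc j , s≤s j≤n , trans (cong (_* q) s≡q^j) (*-comm (q ^ j) q)

-- ¬ d * p i ∣ b is the division-free form of d ∤ b / p i.
prime-powers-∣-divisor : ∀ {m b d} (p e : Fin m → ℕ) → (∀ i → Prime (p i))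
  → prodF (λ i → p i ^ e i) ∣ b → d ∣ b → (∀ i → ¬ d * p i ∣ b) → prodF (λ i → p i ^ e i) ∣ d
prime-powers-∣-divisor {d = d} p e prime-p A∣b (divides c refl) d·p∤b =
  coprime-divisor A⊥c A∣b
  where
  p∤c : ∀ i → ¬ p i ∣ c
  p∤c i (divides c′ refl) =
    d·p∤b i (divides c′ (solve 3 (λ c′ p d → c′ :* p :* d := c′ :* (d :* p)) refl c′ (p i) d))
  A⊥c : Coprime (prodF (λ i → p i ^ e i)) c
  A⊥c = coprime-prodF _ λ i → coprime-^ (e i) (prime∤⇒coprime (prime-p i) (p∤c i))

module _ {N : ℕ} {V : Fin N → Set} where

  Reach-target : ∀ {x y} → V x → Reach N V x y → V y
  Reach-target Vx here           = Vx
  Reach-target Vx (step _ _ Vz)  = Vz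

  Reach-invariant : (Q : Fin N → Set) → (∀ {y z} → V y → V z → Adj N y z → Q y → Q z)
    → ∀ {x y} → V x → Q x → Reach N V x y → Q y
  Reach-invariant Q closed Vx Qx here = Qx
  Reach-invariant Q closed Vx Qx (step r y~z Vz) =
    closed (Reach-target Vx r) Vz y~z (Reach-invariant Q closed Vx Qx r)

  invariant-separates : (Q : Fin N → Set) → (∀ {y z} → V y → V z → Adj N y z → Q y → Q z)
    → ∀ x y → V x → V y → Q x → ¬ Q y → Disconnected N V
  invariant-separates Q closed x y Vx Vy Qx ¬Qy =
    x , y , Vx , Vy , λ r → ¬Qy (Reach-invariant Q closed Vx Qx r)

module Separation (m : ℕ) (m≥1 : 1 ≤ m) (p e : Fin (suc m) → ℕ)
    (prime-p : ∀ i → Prime (p i))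
    (p-increasing : ∀ i j → i Data.Fin.< j → p i < p j)
    (e≥1 : ∀ i → 1 ≤ e i)
    (k : ℕ) (k<nᵣ : k < e (fromℕ m)) where

  N pᵣ nᵣ : ℕ
  N = nOf m p e
  pᵣ = p (fromℕ m)
  nᵣ = e (fromℕ m)

  p′ e′ : Fin m → ℕ
  p′ i = p (inject₁ i)
  e′ i = e (inject₁ i)

  a : ℕ
  a = prodF (λ i → p′ i ^ e′ i)

  αₖ : ℕ
  αₖ = α m p e k

  N≡α[nᵣ] : N ≡ α m p e nᵣ
  N≡α[nᵣ] = prodF-last m (λ i → p i ^ e i)

  instance
    pᵣ≢0 : NonZero pᵣ
    pᵣ≢0 = prime⇒nonZero (prime-p (fromℕ m))
    p′≢0 : ∀ {i} → NonZero (p′ i)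
    p′≢0 = prime⇒nonZero (prime-p _)
    a≢0 : NonZero a
    a≢0 = prodF-nonZero _ λ i → m^n≢0 (p′ i) (e′ i)

  1<pᵣ : 1 < pᵣ
  1<pᵣ = nonTrivial⇒n>1 pᵣ {{prime⇒nonTrivial (prime-p _)}}

  p′⊥pᵣ^ : ∀ i j → Coprime (p′ i) (pᵣ ^ j)
  p′⊥pᵣ^ i j = Coprimality.sym (coprime-^ j (Coprimality.sym
    (distinct-primes-coprime (prime-p _) (prime-p _) (<⇒≢ (p-increasing _ _ inject₁<fromℕ)))))
    where
    inject₁<fromℕ : inject₁ i Data.Fin.< fromℕ m
    inject₁<fromℕ = subst (toℕ (inject₁ i) <_) (sym (toℕ-fromℕ m)) (inject₁ℕ< i)

  a⊥pᵣ^ : ∀ j → Coprime a (pᵣ ^ j)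
  a⊥pᵣ^ j = coprime-prodF _ λ i → coprime-^ (e′ i) (p′⊥pᵣ^ i j)

  p′∣a : ∀ i → p′ i ∣ a
  p′∣a i = ∣-trans (m∣m^n (p′ i) (e≥1 _)) (∣prodF _ i)

  1<a : 1 < a
  1<a = <-≤-trans (nonTrivial⇒n>1 _ {{prime⇒nonTrivial (prime-p (inject₁ i₀))}}) (∣⇒≤ (p′∣a i₀))
    where i₀ = fromℕ< m≥1

  a∤pᵣ^ : ∀ j → ¬ a ∣ pᵣ ^ j
  a∤pᵣ^ j a∣pᵣ^j = <⇒≢ 1<a (sym (a⊥pᵣ^ j (∣-refl , a∣pᵣ^j)))

  pᵣ^nᵣ∤αₖ : ¬ pᵣ ^ nᵣ ∣ αₖ
  pᵣ^nᵣ∤αₖ pᵣ^nᵣ∣αₖ = <⇒≱ (^-monoʳ-< pᵣ 1<pᵣ k<nᵣ)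
    (∣⇒≤ {{m^n≢0 pᵣ k}} (coprime-divisor (Coprimality.sym (a⊥pᵣ^ nᵣ)) pᵣ^nᵣ∣αₖ))

  β*p′≡αₖ : ∀ i → β m p e k i * p′ i ≡ αₖ
  β*p′≡αₖ i = div'-*-inverse (>-nonZero⁻¹ (p′ i)) (∣m⇒∣m*n (pᵣ ^ k) (p′∣a i))

  ∣β⇒∣αₖ : ∀ {d} i → d ∣ β m p e k i → d ∣ αₖ
  ∣β⇒∣αₖ {d} i d∣β = subst (d ∣_) (β*p′≡αₖ i) (∣m⇒∣m*n (p′ i) d∣β)

  ∣β⇒*p′∣αₖ : ∀ {d} i → d ∣ β m p e k i → d * p′ i ∣ αₖ
  ∣β⇒*p′∣αₖ {d} i d∣β = subst (d * p′ i ∣_) (β*p′≡αₖ i) (*-pres-∣ d∣β ∣-refl)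

  a∤β : ∀ i → ¬ a ∣ β m p e k i
  a∤β i a∣β = <⇒≢ (nonTrivial⇒n>1 _ {{prime⇒nonTrivial (prime-p _)}})
    (sym (p′⊥pᵣ^ i k (∣-refl , *-cancelˡ-∣ a (∣β⇒*p′∣αₖ i a∣β))))

  V Q : Fin N → Set
  V x = ¬ InZ m p e k x
  -- Q x ⇔ ord x ∣ α_k, in a form that transfers along powers without computing orders.
  Q x = N ∣ αₖ * toℕ x

  a∣order : ∀ {x o} → V x → IsOrder N x o → o ∣ αₖ → a ∣ o
  a∣order {o = o} Vx ord o∣αₖ =
    prime-powers-∣-divisor p′ e′ (λ i → prime-p _) (m∣m*n (pᵣ ^ k)) o∣αₖ λ i o*p′∣αₖ →
      Vx (inj₂ (inj₂ (i , o , ord , *-cancelʳ-∣ (p′ i) (subst (o * p′ i ∣_) (sym (β*p′≡αₖ i)) o*p′∣αₖ))))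

  a∣d∣N⇒d≡α : ∀ {d} → a ∣ d → d ∣ N → ∃ λ j → j ≤ nᵣ × d ≡ α m p e j
  a∣d∣N⇒d≡α (divides t refl) ta∣N =
    let t∣pᵣ^nᵣ = *-cancelʳ-∣ {t} a (subst (t * a ∣_) (trans N≡α[nᵣ] (*-comm a (pᵣ ^ nᵣ))) ta∣N)
        j , j≤nᵣ , t≡pᵣ^j = ∣prime^⇒≡prime^ (prime-p _) nᵣ t∣pᵣ^nᵣ
    in j , j≤nᵣ , trans (cong (_* a) t≡pᵣ^j) (*-comm (pᵣ ^ j) a)

  order-α⇒≤k : ∀ {x j} → V x → IsOrder N x (α m p e j) → j ≤ nᵣ → j ≤ k
  order-α⇒≤k {j = j} Vx ord j≤nᵣ with j ≤? k
  ... | yes j≤k = j≤k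
  ... | no j≰k with m≤n⇒m<n∨m≡n j≤nᵣ
  ...   | inj₁ j<nᵣ = ⊥-elim (Vx (inj₁ (j , ≰⇒> j≰k , j<nᵣ , ord)))
  ...   | inj₂ refl = ⊥-elim (Vx (inj₂ (inj₁ (subst (IsOrder N _) (sym N≡α[nᵣ]) ord))))

  Q-closed : ∀ {y z} → V y → V z → Adj N y z → Q y → Q z
  Q-closed _  _  (_ , inj₁ y↦z) Qy = annihilates-power {d = αₖ} y↦z Qy
  Q-closed {y} {z} Vy Vz (_ , inj₂ z↦y) Qy =
    let oy , ord-y = order-exists y
        oz , ord-z = order-exists z
        a∣oz = ∣-trans (a∣order Vy ord-y (annihilates⇒order-∣ ord-y Qy)) (order-∣-of-power z↦y ord-z ord-y)
        j , j≤nᵣ , oz≡αⱼ = a∣d∣N⇒d≡α a∣oz (order-∣-modulus ord-z)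
        j≤k = order-α⇒≤k Vz (subst (IsOrder N z) oz≡αⱼ ord-z) j≤nᵣ
    in order-∣⇒annihilates ord-z (subst (_∣ αₖ) (sym oz≡αⱼ) (*-pres-∣ (∣-refl {a}) (^-monoʳ-∣ pᵣ j≤k)))

  a<α : ∀ {j} → 0 < j → a < α m p e j
  a<α j>0 = m<m*n a _ (^-monoʳ-< pᵣ 1<pᵣ j>0)

  pᵣ^nᵣ<N : pᵣ ^ nᵣ < N
  pᵣ^nᵣ<N = subst (pᵣ ^ nᵣ <_) (trans (*-comm (pᵣ ^ nᵣ) a) (sym N≡α[nᵣ]))
    (m<m*n (pᵣ ^ nᵣ) a {{m^n≢0 pᵣ nᵣ}} 1<a)

  x₀ y₀ : Fin N
  x₀ = fromℕ< pᵣ^nᵣ<N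
  y₀ = fromℕ< (subst (a <_) (sym N≡α[nᵣ]) (a<α (e≥1 _)))

  order-x₀ : IsOrder N x₀ a
  order-x₀ = order-of-cofactor {{a≢0}} {{m^n≢0 pᵣ nᵣ}} N≡α[nᵣ] (toℕ-fromℕ< _)

  order-y₀ : IsOrder N y₀ (pᵣ ^ nᵣ)
  order-y₀ = order-of-cofactor {{m^n≢0 pᵣ nᵣ}} (trans N≡α[nᵣ] (*-comm a (pᵣ ^ nᵣ))) (toℕ-fromℕ< _)

  x₀∈V : V x₀
  x₀∈V (inj₁ (j , k<j , _ , ord)) = <⇒≢ (a<α (<-≤-trans z<s k<j)) (order-unique order-x₀ ord)
  x₀∈V (inj₂ (inj₁ ord)) = <⇒≢ (a<α (e≥1 _)) (trans (order-unique order-x₀ ord) N≡α[nᵣ])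
  x₀∈V (inj₂ (inj₂ (i , o , ord , o∣β))) = a∤β i (subst (_∣ β m p e k i) (order-unique ord order-x₀) o∣β)

  y₀-order≢α : ∀ j → ¬ IsOrder N y₀ (α m p e j)
  y₀-order≢α j ord = a∤pᵣ^ nᵣ (divides (pᵣ ^ j) (trans (order-unique order-y₀ ord) (*-comm a (pᵣ ^ j))))

  y₀∈V : V y₀
  y₀∈V (inj₁ (j , _ , _ , ord)) = y₀-order≢α j ord
  y₀∈V (inj₂ (inj₁ ord)) = y₀-order≢α nᵣ (subst (IsOrder N y₀) N≡α[nᵣ] ord)
  y₀∈V (inj₂ (inj₂ (i , o , ord , o∣β))) =
    pᵣ^nᵣ∤αₖ (subst (_∣ αₖ) (order-unique ord order-y₀) (∣β⇒∣αₖ i o∣β))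

  Q[x₀] : Q x₀
  Q[x₀] = order-∣⇒annihilates order-x₀ (m∣m*n (pᵣ ^ k))

  ¬Q[y₀] : ¬ Q y₀
  ¬Q[y₀] Qy₀ = pᵣ^nᵣ∤αₖ (annihilates⇒order-∣ order-y₀ Qy₀)

proposition3p1 : (m : ℕ) → 1 ≤ m → (p e : Fin (suc m) → ℕ)
    → (∀ i → Prime (p i))
    → (∀ i j → i Data.Fin.< j → p i < p j)
    → (∀ i → 1 ≤ e i)
    → (k : ℕ) → k < e (fromℕ m)
    → Disconnected (nOf m p e) (λ x → ¬ InZ m p e k x)
proposition3p1 m m≥1 p e prime-p p-increasing e≥1 k k<nᵣ =
  invariant-separates Q Q-closed x₀ y₀ x₀∈V y₀∈V Q[x₀] ¬Q[y₀]
  where open Separation m m≥1 p e prime-p p-increasing e≥1 k k<nᵣ
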